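{- Let $G$ be a finite graph whose vertex set is partitioned into $V_1 \sqcup V_2 \sqcup \dots \sqcup V_m$. Let $q$ be a prime power with $q > 2N(v) + N^2(v)$ for every vertex $v$ of $G$. If $|V_j| \ge 2q-1$ for all $j$, then there are $q$ pairwise disjoint independent sets $S_1, \dots, S_q$ of $G$ such that each $S_i$ intersects each $V_j$.
   Context: For a vertex $v$, $N(v)$ denotes the number of neighbors of $v$, and $N^2(v)$ the number of vertices at distance exactly two from $v$. A set of vertices is independent if it contains no two endpoints of an edge. -}

module Defs where

open import Data.Nat using (ℕ; zero; suc; _+_; _^_; _≤_)
open import Data.Nat.Primality using (Prime)
open import Data.Fin using (Fin; zero; suc)
open import Data.Bool using (Bool; true; false; _∧_; not; if_then_else_)
open import Data.Product using (Σ; _×_; ∃)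
open import Relation.Binary.PropositionalEquality using (_≡_)
open import Relation.Nullary using (¬_; does)
open import Data.Fin.Properties using (_≟_)

count : {n : ℕ} → (Fin n → Bool) → ℕ
count {zero} p = 0
count {suc n} p = (if p zero then 1 else 0) + count (λ i → p (suc i))

anyFin : {n : ℕ} → (Fin n → Bool) → Bool
anyFin {zero} p = false
anyFin {suc n} p = if p zero then true else anyFin (λ i → p (suc i))

record Graph (n : ℕ) : Set where
  field
    adj    : Fin n → Fin n → Bool
    sym    : ∀ u v → adj u v ≡ adj v u
    irrefl : ∀ v → adj v v ≡ false
open Graph public

deg : {n : ℕ} → Graph n → Fin n → ℕ
deg G v = count (adj G v)

dist2 : {n : ℕ} → Graph n → Fin n → Fin n → Bool
dist2 G v u = not (does (u ≟ v)) ∧ not (adj G v u) ∧ anyFin (λ w → adj G v w ∧ adj G w u)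

deg2 : {n : ℕ} → Graph n → Fin n → ℕ
deg2 G v = count (dist2 G v)

IsPrimePower : ℕ → Set
IsPrimePower q = Σ ℕ λ p → Σ ℕ λ k → Prime p × 1 ≤ k × q ≡ p ^ k

Independent : {n : ℕ} → Graph n → (Fin n → Bool) → Set
Independent G S = ∀ u v → S u ≡ true → S v ≡ true → adj G u v ≡ false

-- The proof is combinatorial and goes through independent transversals.
--  * Haxell-type theorem (module IndependentTransversal): if any two vertices
--    have at most q neighbours in total and each class holds q available
--    vertices, some independent set of available vertices meets every class.
--    A partial transversal missing a class r is augmented by growing an
--    alternating chain of vertices x_i and their neighbours y_i in the
--    transversal; a counting argument (classes of the chain hold more
--    available vertices than are adjacent to the chain) always provides a
--    next vertex, and a lexicographic potential shows the process stops.
--  * Greedy repetition (module DisjointTransversals): after k < q disjoint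
--    transversals, each class still has q unused vertices, so a further one
--    exists through unused vertices.
--  * The theorem: 2N(v) < q gives N(x) + N(y) ≤ q, and 2q − 1 = (q − 1) + q.

module Submission where

open import Defs
open import Data.Nat using (ℕ; _+_; _*_; _∸_; _<_; _≤_)
open import Data.Fin using (Fin)
open import Data.Bool using (Bool; true)
open import Data.Product using (Σ; _×_; ∃)
open import Relation.Binary.PropositionalEquality using (_≡_)
open import Relation.Nullary using (¬_)
open import Data.Fin.Properties using (_≟_)
open import Relation.Nullary using (does)

open import Data.Nat using (zero; suc; _^_; z≤n; s≤s; NonZero)
open import Data.Nat.Properties
  using (≤-refl; ≤-reflexive; ≤-trans; ≤-<-trans; <-≤-trans; ≤-pred; <⇒≤; <⇒≱; n≤1+n; n<1+n; 1+n≰n; m≤n⇒m≤1+n;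
         m≤m+n; m∸n≤m; +-comm; +-assoc; +-suc; +-identityʳ; +-mono-≤; +-monoˡ-≤; +-monoʳ-≤; +-monoʳ-<; +-mono-<;
         +-cancelˡ-≤; *-assoc; *-identityʳ; *-distribˡ-+; *-monoˡ-≤; *-monoʳ-≤; *-monoˡ-<; *-cancelˡ-<; m^n≢0;
         module ≤-Reasoning)
open import Data.Fin using (zero; suc)
open import Data.Fin.Properties using (suc-injective)
open import Data.Bool using (false; _∧_; _∨_; not)
open import Data.Bool.Properties
  using (∧-conicalˡ; ∧-conicalʳ; ∨-conicalˡ; ∨-conicalʳ; ∧-comm; ∧-distribˡ-∨; not-injective; not-involutive; ¬-not)
open import Data.Product using (_,_; proj₁; proj₂)
open import Data.Sum using (_⊎_; inj₁; inj₂)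
open import Data.Empty using (⊥; ⊥-elim)
open import Data.Unit using (⊤; tt)
open import Data.Vec.Functional using (tail)
open import Data.List using (List; []; _∷_; length; allFin)
open import Data.List.Membership.Propositional using (_∈_)
open import Data.List.Membership.Propositional.Properties using (∈-allFin)
open import Data.List.Relation.Unary.All using (All; []; _∷_) renaming (lookup to All-lookup)
open import Data.List.Relation.Unary.Any using (here; there)
open import Data.List.Relation.Unary.Unique.Propositional using (Unique; []; _∷_)
open import Relation.Binary.PropositionalEquality
  using (_≢_; ≢-sym; refl; trans; cong; subst; subst₂) renaming (sym to ≡-sym)
open import Relation.Nullary using (Dec; yes; no)
open import Relation.Nullary.Decidable using (dec-true; dec-false)

∧-intro : ∀ {a b} → a ≡ true → b ≡ true → a ∧ b ≡ true
∧-intro refl refl = refl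

∨-elim : ∀ {a b} → a ∨ b ≡ true → a ≡ true ⊎ b ≡ true
∨-elim {true}  _ = inj₁ refl
∨-elim {false} e = inj₂ e

∨-introˡ : ∀ {a b} → a ≡ true → a ∨ b ≡ true
∨-introˡ refl = refl

∨-introʳ : ∀ a {b} → b ≡ true → a ∨ b ≡ true
∨-introʳ true  _ = refl
∨-introʳ false e = e

true≢false : ∀ {a} → a ≡ true → a ≡ false → ⊥
true≢false refl ()

does-sound : ∀ {P : Set} (d : Dec P) → does d ≡ true → P
does-sound (yes p) _ = p

count-≤ : ∀ {n} (p : Fin n → Bool) → count p ≤ n
count-≤ {zero}  p = z≤n
count-≤ {suc n} p with p zero
... | true  = s≤s (count-≤ (tail p))
... | false = m≤n⇒m≤1+n (count-≤ (tail p))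

count-cong : ∀ {n} (p p′ : Fin n → Bool) → (∀ v → p v ≡ p′ v) → count p ≡ count p′
count-cong {zero}  p p′ h = refl
count-cong {suc n} p p′ h rewrite h zero =
  cong (_ +_) (count-cong (tail p) (tail p′) (λ i → h (suc i)))

count-empty : ∀ {n} (p : Fin n → Bool) → (∀ v → p v ≡ false) → count p ≡ 0
count-empty {zero}  p h = refl
count-empty {suc n} p h rewrite h zero = count-empty _ (λ i → h (suc i))

count-mono : ∀ {n} (p p′ : Fin n → Bool) → (∀ v → p v ≡ true → p′ v ≡ true) → count p ≤ count p′
count-mono {zero}  p p′ h = z≤n
count-mono {suc n} p p′ h with p zero in e | p′ zero in e′
... | true  | true  = s≤s (count-mono _ _ (λ i → h (suc i)))
... | true  | false = ⊥-elim (true≢false (h zero e) e′)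
... | false | true  = m≤n⇒m≤1+n (count-mono _ _ (λ i → h (suc i)))
... | false | false = count-mono _ _ (λ i → h (suc i))

count-mono-< : ∀ {n} (p p′ : Fin n → Bool) → (∀ v → p v ≡ true → p′ v ≡ true) →
               (w : Fin n) → p w ≡ false → p′ w ≡ true → count p < count p′
count-mono-< {suc n} p p′ h zero pw p′w rewrite pw | p′w = s≤s (count-mono _ _ (λ i → h (suc i)))
count-mono-< {suc n} p p′ h (suc w) pw p′w with p zero in e | p′ zero in e′
... | true  | true  = s≤s (count-mono-< _ _ (λ i → h (suc i)) w pw p′w)
... | true  | false = ⊥-elim (true≢false (h zero e) e′)
... | false | true  = m≤n⇒m≤1+n (count-mono-< _ _ (λ i → h (suc i)) w pw p′w)
... | false | false = count-mono-< _ _ (λ i → h (suc i)) w pw p′w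

count-∨ : ∀ {n} (p p′ : Fin n → Bool) → count (λ v → p v ∨ p′ v) ≤ count p + count p′
count-∨ {zero}  p p′ = z≤n
count-∨ {suc n} p p′ with p zero | p′ zero
... | true  | true  = s≤s (≤-trans (count-∨ (tail p) (tail p′)) (+-monoʳ-≤ (count (tail p)) (n≤1+n _)))
... | true  | false = s≤s (count-∨ (tail p) (tail p′))
... | false | true  = ≤-trans (s≤s (count-∨ (tail p) (tail p′))) (≤-reflexive (≡-sym (+-suc _ _)))
... | false | false = count-∨ (tail p) (tail p′)

count-∨-disjoint : ∀ {n} (p p′ : Fin n → Bool) → (∀ v → p v ≡ true → p′ v ≡ true → ⊥) →
                   count p + count p′ ≤ count (λ v → p v ∨ p′ v)
count-∨-disjoint {zero}  p p′ h = z≤n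
count-∨-disjoint {suc n} p p′ h with p zero in e | p′ zero in e′
... | true  | true  = ⊥-elim (h zero e e′)
... | true  | false = s≤s (count-∨-disjoint _ _ (λ i → h (suc i)))
... | false | true  = ≤-trans (≤-reflexive (+-suc _ _)) (s≤s (count-∨-disjoint _ _ (λ i → h (suc i))))
... | false | false = count-∨-disjoint _ _ (λ i → h (suc i))

count-≤1 : ∀ {n} (p : Fin n → Bool) → (∀ u v → p u ≡ true → p v ≡ true → u ≡ v) → count p ≤ 1
count-≤1 {zero}  p h = z≤n
count-≤1 {suc n} p h with p zero in e
... | true  = s≤s (≤-reflexive (count-empty _ (λ i → ¬-not (λ pi → 0≢suc (h zero (suc i) e pi)))))
  where 0≢suc : ∀ {i : Fin n} → zero ≢ suc i
        0≢suc ()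
... | false = count-≤1 _ (λ u v pu pv → suc-injective (h (suc u) (suc v) pu pv))

anyFin-false : ∀ {k} (p : Fin k → Bool) → anyFin p ≡ false → ∀ i → p i ≡ false
anyFin-false {suc k} p none i with p zero in p0
anyFin-false {suc k} p none zero    | false = p0
anyFin-false {suc k} p none (suc i) | false = anyFin-false (tail p) none i

count-image : ∀ {n} k (f : Fin k → Fin n) → count (λ v → anyFin (λ i → does (f i ≟ v))) ≤ k
count-image {n} zero f = ≤-reflexive (count-empty {n} _ (λ v → refl))
count-image (suc k) f = begin
  count (λ v → anyFin (λ i → does (f i ≟ v)))
    ≡⟨ count-cong _ _ first-or-rest ⟩
  count (λ v → does (f zero ≟ v) ∨ anyFin (λ i → does (f (suc i) ≟ v)))
    ≤⟨ count-∨ (λ v → does (f zero ≟ v)) _ ⟩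
  count (λ v → does (f zero ≟ v)) + count (λ v → anyFin (λ i → does (f (suc i) ≟ v)))
    ≤⟨ +-mono-≤ (count-≤1 _ only-f0) (count-image k (tail f)) ⟩
  1 + k ∎
  where
    open ≤-Reasoning
    first-or-rest : ∀ v → anyFin (λ i → does (f i ≟ v)) ≡ (does (f zero ≟ v) ∨ anyFin (λ i → does (f (suc i) ≟ v)))
    first-or-rest v with does (f zero ≟ v)
    ... | true  = refl
    ... | false = refl
    only-f0 : ∀ u v → does (f zero ≟ u) ≡ true → does (f zero ≟ v) ≡ true → u ≡ v
    only-f0 u v eu ev = trans (≡-sym (does-sound (f zero ≟ u) eu)) (does-sound (f zero ≟ v) ev)

count-split : ∀ {n} (p a : Fin n → Bool) → count p ≤ count (λ v → p v ∧ a v) + count (λ v → p v ∧ not (a v))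
count-split p a = ≤-trans (count-mono p _ covered) (count-∨ (λ v → p v ∧ a v) (λ v → p v ∧ not (a v)))
  where covered : ∀ v → p v ≡ true → (p v ∧ a v) ∨ (p v ∧ not (a v)) ≡ true
        covered v e rewrite e with a v
        ... | true  = refl
        ... | false = refl

search : ∀ {n} (p : Fin n → Bool) → (Σ (Fin n) λ v → p v ≡ true) ⊎ (∀ v → p v ≡ false)
search {zero}  p = inj₂ (λ ())
search {suc n} p with p zero in e
... | true  = inj₁ (zero , e)
... | false with search (tail p)
...   | inj₁ (v , ev) = inj₁ (suc v , ev)
...   | inj₂ h        = inj₂ λ { zero → e ; (suc i) → h i }

count-gap : ∀ {n} (p p′ : Fin n → Bool) → count p′ < count p → Σ (Fin n) λ v → p v ≡ true × p′ v ≡ false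
count-gap p p′ lt with search (λ v → p v ∧ not (p′ v))
... | inj₁ (v , e) = v , ∧-conicalˡ (p v) _ e , not-injective (∧-conicalʳ (p v) _ e)
... | inj₂ h       = ⊥-elim (<⇒≱ lt (count-mono p p′ inclusion))
  where inclusion : ∀ v → p v ≡ true → p′ v ≡ true
        inclusion v e with p′ v in e′
        ... | true  = refl
        ... | false = ⊥-elim (true≢false (∧-intro e (cong not e′)) (h v))

-- The termination measure of the
-- augmentation below is a numeral whose digits are neighbour counts; these
-- three facts say how it changes when a digit is appended, when the last
-- digit is dropped (padding with a zero), and when the digits shrink.

numeral-append : ∀ W .{{_ : NonZero W}} X b s → suc b < W →
                 suc (X * W + b) * W ^ s < suc X * W ^ suc s
numeral-append W X b s b+1<W = begin-strict
  suc (X * W + b) * W ^ s  <⟨ *-monoˡ-< (W ^ s) {{m^n≢0 W s}} digit-fits ⟩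
  (suc X * W) * W ^ s      ≡⟨ *-assoc (suc X) W (W ^ s) ⟩
  suc X * W ^ suc s        ∎
  where
    open ≤-Reasoning
    digit-fits : suc (X * W + b) < suc X * W
    digit-fits = begin-strict
      suc (X * W + b)  ≡⟨ ≡-sym (+-suc (X * W) b) ⟩
      X * W + suc b    <⟨ +-monoʳ-< (X * W) b+1<W ⟩
      X * W + W        ≡⟨ +-comm (X * W) W ⟩
      suc X * W        ∎

numeral-drop : ∀ W X b s → X * W ^ suc s ≤ (X * W + b) * W ^ s
numeral-drop W X b s = begin
  X * (W * W ^ s)    ≡⟨ ≡-sym (*-assoc X W (W ^ s)) ⟩
  X * W * W ^ s      ≤⟨ *-monoˡ-≤ (W ^ s) (m≤m+n (X * W) b) ⟩
  (X * W + b) * W ^ s ∎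
  where open ≤-Reasoning

numeral-lower : ∀ W {X′ X b′ b} s → X′ ≤ X → b′ < b →
                suc (X′ * W + b′) * W ^ s ≤ (X * W + b) * W ^ s
numeral-lower W s X′≤X b′<b = *-monoˡ-≤ (W ^ s)
  (≤-trans (≤-reflexive (≡-sym (+-suc _ _))) (+-mono-≤ (*-monoˡ-≤ W X′≤X) b′<b))

-- Independent transversals through available vertices (a Haxell-type theorem).
module IndependentTransversal
  {n m : ℕ} (G : Graph n) (part : Fin n → Fin m) (A : Fin n → Bool) (q : ℕ) (q≥1 : 1 ≤ q)
  (degree-bound : ∀ x y → deg G x + deg G y ≤ q)
  (class-size : ∀ j → q ≤ count (λ v → A v ∧ does (part v ≟ j))) where

  open import Data.List.Membership.DecPropositional (_≟_ {m}) using (_∈?_)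

  adj-sym : ∀ {u v} → adj G u v ≡ true → adj G v u ≡ true
  adj-sym {u} {v} e = trans (Graph.sym G v u) e

  record Partial (I : Fin n → Bool) : Set where
    field
      available   : ∀ {v} → I v ≡ true → A v ≡ true
      independent : ∀ {u v} → I u ≡ true → I v ≡ true → adj G u v ≡ false
      rainbow     : ∀ {u v} → I u ≡ true → I v ≡ true → part u ≡ part v → u ≡ v
  open Partial

  Covers : (Fin n → Bool) → Fin m → Set
  Covers I j = Σ (Fin n) λ v → I v ≡ true × part v ≡ j

  _⊒_ : (Fin n → Bool) → (Fin n → Bool) → Set
  I′ ⊒ I = ∀ j → Covers I j → Covers I′ j

  Misses : (Fin n → Bool) → Fin m → Set
  Misses I r = ∀ {v} → I v ≡ true → part v ≢ r

  Isolated : (Fin n → Bool) → Fin n → Set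
  Isolated I x = ∀ {v} → I v ≡ true → adj G x v ≡ false

  available-in : List (Fin m) → Fin n → Bool
  available-in js v = A v ∧ does (part v ∈? js)

  count-available : ∀ js → Unique js → length js * q ≤ count (available-in js)
  count-available []       _              = z≤n
  count-available (j ∷ js) (j∉js ∷ uniq) = begin
    q + length js * q
      ≤⟨ +-mono-≤ (class-size j) (count-available js uniq) ⟩
    count (λ v → A v ∧ does (part v ≟ j)) + count (available-in js)
      ≤⟨ count-∨-disjoint _ _ disjoint ⟩
    count (λ v → (A v ∧ does (part v ≟ j)) ∨ available-in js v)
      ≡⟨ count-cong _ _ (λ v → ≡-sym (∧-distribˡ-∨ (A v) _ _)) ⟩
    count (available-in (j ∷ js)) ∎
    where
      open ≤-Reasoning
      disjoint : ∀ v → A v ∧ does (part v ≟ j) ≡ true → available-in js v ≡ true → ⊥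
      disjoint v in-j in-js =
        All-lookup j∉js (does-sound (part v ∈? js) (∧-conicalʳ (A v) _ in-js))
                        (≡-sym (does-sound (part v ≟ j) (∧-conicalʳ (A v) _ in-j)))

  insert : (Fin n → Bool) → Fin n → Fin n → Bool
  insert I x v = (I v ∧ not (does (part v ≟ part x))) ∨ does (v ≟ x)

  insert-cases : ∀ I x {v} → insert I x v ≡ true → (I v ≡ true × part v ≢ part x) ⊎ v ≡ x
  insert-cases I x {v} e with ∨-elim {I v ∧ not (does (part v ≟ part x))} e
  ... | inj₁ kept = inj₁ (∧-conicalˡ (I v) _ kept , λ same →
          true≢false (dec-true (part v ≟ part x) same) (not-injective (∧-conicalʳ (I v) _ kept)))
  ... | inj₂ new  = inj₂ (does-sound (v ≟ x) new)

  insert-⊆ : ∀ I x {v} → insert I x v ≡ true → I v ≡ true ⊎ v ≡ x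
  insert-⊆ I x e with insert-cases I x e
  ... | inj₁ (Iv , _) = inj₁ Iv
  ... | inj₂ v≡x      = inj₂ v≡x

  insert-keeps : ∀ I x {v} → I v ≡ true → part v ≢ part x → insert I x v ≡ true
  insert-keeps I x {v} Iv other-class =
    ∨-introˡ (∧-intro Iv (cong not (dec-false (part v ≟ part x) other-class)))

  insert-new : ∀ I x → insert I x x ≡ true
  insert-new I x = ∨-introʳ (I x ∧ _) (dec-true (x ≟ x) refl)

  insert-evicts : ∀ I x {y} → part y ≡ part x → y ≢ x → insert I x y ≡ false
  insert-evicts I x {y} same y≢x = ¬-not λ e → impossible (insert-cases I x e)
    where impossible : (I y ≡ true × part y ≢ part x) ⊎ y ≡ x → ⊥
          impossible (inj₁ (_ , other-class)) = other-class same
          impossible (inj₂ y≡x)              = y≢x y≡x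

  -- Inserting an available vertex with no neighbour in I keeps I partial,
  -- and loses no covered class (x takes over the class of the evicted vertex).
  insert-partial : ∀ {I x} → Partial I → A x ≡ true → Isolated I x → Partial (insert I x)
  insert-partial {I} {x} P Ax iso = record { available = avail ; independent = indep ; rainbow = rb }
    where
      avail : ∀ {v} → insert I x v ≡ true → A v ≡ true
      avail e with insert-⊆ I x e
      ... | inj₁ Iv   = available P Iv
      ... | inj₂ refl = Ax
      indep : ∀ {u v} → insert I x u ≡ true → insert I x v ≡ true → adj G u v ≡ false
      indep eu ev with insert-⊆ I x eu | insert-⊆ I x ev
      ... | inj₁ Iu   | inj₁ Iv   = independent P Iu Iv
      ... | inj₁ Iu   | inj₂ refl = trans (Graph.sym G _ x) (iso Iu)
      ... | inj₂ refl | inj₁ Iv   = iso Iv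
      ... | inj₂ refl | inj₂ refl = Graph.irrefl G x
      rb : ∀ {u v} → insert I x u ≡ true → insert I x v ≡ true → part u ≡ part v → u ≡ v
      rb eu ev same with insert-cases I x eu | insert-cases I x ev
      ... | inj₁ (Iu , _)  | inj₁ (Iv , _)  = rainbow P Iu Iv same
      ... | inj₁ (_ , out) | inj₂ refl      = ⊥-elim (out same)
      ... | inj₂ refl      | inj₁ (_ , out) = ⊥-elim (out (≡-sym same))
      ... | inj₂ refl      | inj₂ refl      = refl

  insert-⊒ : ∀ I x → insert I x ⊒ I
  insert-⊒ I x j (w , Iw , pw) with part w ≟ part x
  ... | yes same        = x , insert-new I x , trans (≡-sym same) pw
  ... | no  other-class = w , insert-keeps I x Iw other-class , pw

  insert-misses : ∀ {I x r} → Misses I r → part x ≢ r → Misses (insert I x) r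
  insert-misses {I} {x} miss px≢r e with insert-⊆ I x e
  ... | inj₁ Iv   = miss Iv
  ... | inj₂ refl = px≢r

  nbrs-in : (Fin n → Bool) → Fin n → ℕ
  nbrs-in I x = count (λ v → I v ∧ adj G x v)

  nbrs-⊆ : ∀ (I I′ : Fin n → Bool) {z} x → (∀ {v} → I′ v ≡ true → I v ≡ true ⊎ v ≡ z) →
           adj G x z ≡ false → ∀ v → I′ v ∧ adj G x v ≡ true → I v ∧ adj G x v ≡ true
  nbrs-⊆ I I′ x ⊆ x≁z v e with ⊆ {v} (∧-conicalˡ (I′ v) _ e)
  ... | inj₁ Iv   = ∧-intro {I v} Iv (∧-conicalʳ (I′ v) _ e)
  ... | inj₂ refl = ⊥-elim (true≢false (∧-conicalʳ (I′ v) _ e) x≁z)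

  module Augment (r : Fin m) where

    data Chain : Set where
      ε   : Chain
      _▸_ : Chain → Fin n × Fin n → Chain

    size : Chain → ℕ
    size ε       = 0
    size (c ▸ _) = suc (size c)

    -- The classes the next vertex x_{k+1} may come from: r, part y₁, …, part y_k.
    classes : Chain → List (Fin m)
    classes ε             = r ∷ []
    classes (c ▸ (_ , y)) = part y ∷ classes c

    length-classes : ∀ c → length (classes c) ≡ suc (size c)
    length-classes ε       = refl
    length-classes (c ▸ _) = cong suc (length-classes c)

    Fresh : Chain → Fin n → Set
    Fresh ε             z = ⊤
    Fresh (c ▸ (x , y)) z = Fresh c z × adj G x z ≡ false × adj G y z ≡ false

    Candidate : Chain → Fin n → Set
    Candidate c z = A z ≡ true × part z ∈ classes c × Fresh c z

    Valid : (Fin n → Bool) → Chain → Set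
    Valid I ε             = ⊤
    Valid I (c ▸ (x , y)) = Valid I c × Candidate c x × adj G x y ≡ true × I y ≡ true

    outside-classes : ∀ {I z w} → Partial I → Misses I r → ∀ c → Valid I c → Fresh c z →
                      I w ≡ true → adj G z w ≡ true → All (part w ≢_) (classes c)
    outside-classes P miss ε _ _ Iw _ = miss Iw ∷ []
    outside-classes {z = z} P miss (c ▸ (x , y)) (valid , _ , _ , Iy) (fresh , _ , y≁z) Iw z~w =
      (λ same → true≢false (adj-sym (subst (λ u → adj G z u ≡ true) (rainbow P Iw Iy same) z~w)) y≁z)
      ∷ outside-classes P miss c valid fresh Iw z~w

    classes-unique : ∀ {I} → Partial I → Misses I r → ∀ c → Valid I c → Unique (classes c)
    classes-unique P miss ε             _ = [] ∷ []
    classes-unique P miss (c ▸ (x , y)) (valid , (_ , _ , fresh) , x~y , Iy) =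
      outside-classes P miss c valid fresh Iy x~y ∷ classes-unique P miss c valid

    near : Chain → Fin n → Bool
    near ε             v = false
    near (c ▸ (x , y)) v = adj G x v ∨ (adj G y v ∨ near c v)

    count-near : ∀ c → count (near c) ≤ size c * q
    count-near ε             = ≤-reflexive (count-empty (near ε) (λ v → refl))
    count-near (c ▸ (x , y)) = begin
      count (near (c ▸ (x , y)))                     ≤⟨ count-∨ (adj G x) _ ⟩
      deg G x + count (λ v → adj G y v ∨ near c v)  ≤⟨ +-monoʳ-≤ (deg G x) (count-∨ (adj G y) (near c)) ⟩
      deg G x + (deg G y + count (near c))          ≡⟨ ≡-sym (+-assoc (deg G x) (deg G y) _) ⟩
      deg G x + deg G y + count (near c)            ≤⟨ +-mono-≤ (degree-bound x y) (count-near c) ⟩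
      q + size c * q                                ∎
      where open ≤-Reasoning

    fresh-if-not-near : ∀ c z → near c z ≡ false → Fresh c z
    fresh-if-not-near ε             z _ = tt
    fresh-if-not-near (c ▸ (x , y)) z e =
      fresh-if-not-near c z (∨-conicalʳ (adj G y z) _ (∨-conicalʳ (adj G x z) _ e)) ,
      ∨-conicalˡ (adj G x z) _ e , ∨-conicalˡ (adj G y z) _ (∨-conicalʳ (adj G x z) _ e)

    -- Key counting step: the classes of a valid chain hold at least
    -- (size c + 1)·q available vertices, but at most (size c)·q vertices are
    -- near the chain, so a candidate exists.
    next-candidate : ∀ {I} → Partial I → Misses I r → ∀ c → Valid I c →
                     Σ (Fin n) (Candidate c) × suc (size c) ≤ n
    next-candidate P miss c valid = (z , in-classes) , short
      where
        U : Fin n → Bool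
        U = available-in (classes c)
        enough : suc (size c) * q ≤ count U
        enough = subst (λ k → k * q ≤ count U) (length-classes c)
                       (count-available (classes c) (classes-unique P miss c valid))
        near<U : count (near c) < count U
        near<U = ≤-<-trans (count-near c) (<-≤-trans (+-monoˡ-≤ (size c * q) q≥1) enough)
        gap : Σ (Fin n) λ v → U v ≡ true × near c v ≡ false
        gap = count-gap U (near c) near<U
        z : Fin n
        z = proj₁ gap
        in-classes : Candidate c z
        in-classes with proj₂ gap
        ... | Uz , far = ∧-conicalˡ (A z) _ Uz ,
                         does-sound (part z ∈? classes c) (∧-conicalʳ (A z) _ Uz) ,
                         fresh-if-not-near c z far
        short : suc (size c) ≤ n
        short = begin
          suc (size c)      ≡⟨ ≡-sym (*-identityʳ (suc (size c))) ⟩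
          suc (size c) * 1  ≤⟨ *-monoʳ-≤ (suc (size c)) q≥1 ⟩
          suc (size c) * q  ≤⟨ enough ⟩
          count U           ≤⟨ count-≤ U ⟩
          n                 ∎
          where open ≤-Reasoning

    -- The potential of a chain: the neighbour counts nbrs-in I x_i of its
    -- x-vertices, read as the digits of a numeral in base W > n.
    W : ℕ
    W = suc (suc n)

    digits : (Fin n → Bool) → Chain → ℕ
    digits I ε             = 0
    digits I (c ▸ (x , _)) = digits I c * W + nbrs-in I x

    digits-mono : ∀ (I I′ : Fin n → Bool) {z} → (∀ {v} → I′ v ≡ true → I v ≡ true ⊎ v ≡ z) →
                  ∀ c → Fresh c z → digits I′ c ≤ digits I c
    digits-mono I I′ ⊆ ε             _                  = z≤n
    digits-mono I I′ ⊆ (c ▸ (x , _)) (fresh , x≁z , _) =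
      +-mono-≤ (*-monoˡ-≤ W (digits-mono I I′ ⊆ c fresh)) (count-mono _ _ (nbrs-⊆ I I′ x ⊆ x≁z))

    valid-insert : ∀ {I x} c → Valid I c → All (part x ≢_) (classes c) → Valid (insert I x) c
    valid-insert         ε             _                         _              = tt
    valid-insert {I} {x} (c ▸ (_ , y)) (valid , cand , x~y , Iy) (px≢py ∷ rest) =
      valid-insert c valid rest , cand , x~y , insert-keeps I x Iy (≢-sym px≢py)

    Augmented : (Fin n → Bool) → Set
    Augmented I₀ = Σ (Fin n → Bool) λ I → Partial I × I ⊒ I₀ × Covers I r

    module Search (I₀ : Fin n → Bool) where

      record State : Set where
        constructor state
        field
          I         : Fin n → Bool
          chain     : Chain
          x         : Fin n
          s         : ℕ
          partial   : Partial I
          misses    : Misses I r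
          valid     : Valid I chain
          candidate : Candidate chain x
          room      : suc (size chain + s) ≡ n
          covers    : I ⊒ I₀

      -- The digits of the chain followed by nbrs-in I x, padded to n digits.
      potential : State → ℕ
      potential S = suc (digits I chain * W + nbrs-in I x) * W ^ s
        where open State S

      Progress : ℕ → Set
      Progress bound = Augmented I₀ ⊎ Σ State λ S′ → potential S′ < bound

      -- The candidate x has no neighbour in I: walk back along the chain to
      -- the link whose class contains x.  If it is r, adding x finishes; if it
      -- is the class of y₀ in a link (x₀ , y₀), x replaces y₀, the chain is cut
      -- back to before that link, and x₀ (which lost its neighbour y₀) becomes
      -- the candidate again.
      module WhenIsolated {I x} (P : Partial I) (miss : Misses I r) (Ax : A x ≡ true)
                          (iso : Isolated I x) (cov : I ⊒ I₀) where

        done : part x ≡ r → Augmented I₀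
        done px≡r = insert I x , insert-partial P Ax iso , (λ j c → insert-⊒ I x j (cov j c)) ,
                    (x , insert-new I x , px≡r)

        -- The digits before x₀ do not grow (x is fresh for c) and the digit of
        -- x₀ drops (y₀ left I, and x is not adjacent to x₀).
        swap : ∀ c x₀ y₀ s → Valid I (c ▸ (x₀ , y₀)) → Fresh (c ▸ (x₀ , y₀)) x → part x ≡ part y₀ →
               suc (size c + s) ≡ n → ∀ {bound} → digits I (c ▸ (x₀ , y₀)) * W ^ s < bound →
               Σ State λ S′ → potential S′ < bound
        swap c x₀ y₀ s (valid , cand@(_ , _ , x₀-fresh) , x₀~y₀ , Iy₀) (fresh , x₀≁x , _) px≡py₀ room bd =
          state I′ c x₀ s (insert-partial P Ax iso) (insert-misses miss px≢r) (valid-insert c valid outside)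
                cand room (λ j cv → insert-⊒ I x j (cov j cv)) ,
          ≤-<-trans (numeral-lower W s (digits-mono I I′ (insert-⊆ I x) c fresh) fewer) bd
          where
            I′ : Fin n → Bool
            I′ = insert I x
            px≢r : part x ≢ r
            px≢r px≡r = miss Iy₀ (trans (≡-sym px≡py₀) px≡r)
            outside : All (part x ≢_) (classes c)
            outside = subst (λ k → All (k ≢_) (classes c)) (≡-sym px≡py₀)
                            (outside-classes P miss c valid x₀-fresh Iy₀ x₀~y₀)
            y₀≢x : y₀ ≢ x
            y₀≢x y₀≡x = true≢false (subst (λ u → adj G x₀ u ≡ true) y₀≡x x₀~y₀) x₀≁x
            evicted : I′ y₀ ∧ adj G x₀ y₀ ≡ false
            evicted rewrite insert-evicts I x (≡-sym px≡py₀) y₀≢x = refl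
            fewer : nbrs-in I′ x₀ < nbrs-in I x₀
            fewer = count-mono-< _ _ (nbrs-⊆ I I′ x₀ (insert-⊆ I x) x₀≁x) y₀ evicted
                                 (∧-intro {I y₀} Iy₀ x₀~y₀)

        walk : ∀ c s → Valid I c → Fresh c x → part x ∈ classes c → size c + s ≡ n →
               ∀ {bound} → digits I c * W ^ s < bound → Progress bound
        walk ε _ _ _ (here px≡r) _ _ = inj₁ (done px≡r)
        walk ε _ _ _ (there ())  _ _
        walk (c ▸ (x₀ , y₀)) s valid fresh (here px≡py₀) room bd =
          inj₂ (swap c x₀ y₀ s valid fresh px≡py₀ room bd)
        walk (c ▸ (x₀ , y₀)) s (valid , _) (fresh , _) (there px∈c) room bd =
          walk c (suc s) valid fresh px∈c (trans (+-suc (size c) s) room)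
               (≤-<-trans (numeral-drop W (digits I c) (nbrs-in I x₀) s) bd)

      step : (S : State) → Progress (potential S)
      step (state I c x s P miss valid cand@(Ax , px∈c , fresh) room cov)
        with search (λ v → I v ∧ adj G x v)
      ... | inj₁ (y , e) = inj₂ (extend s room)
        where
          valid′ : Valid I (c ▸ (x , y))
          valid′ = valid , cand , ∧-conicalʳ (I y) _ e , ∧-conicalˡ (I y) _ e
          next : Σ (Fin n) (Candidate (c ▸ (x , y))) × suc (size (c ▸ (x , y))) ≤ n
          next = next-candidate P miss (c ▸ (x , y)) valid′
          extend : ∀ s → suc (size c + s) ≡ n →
                   Σ State λ S′ → potential S′ < suc (digits I c * W + nbrs-in I x) * W ^ s
          extend zero room = ⊥-elim (1+n≰n (≤-trans (proj₂ next)
                                     (≤-reflexive (trans (≡-sym room) (cong suc (+-identityʳ (size c)))))))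
          extend (suc s′) room =
            state I (c ▸ (x , y)) (proj₁ (proj₁ next)) s′ P miss valid′ (proj₂ (proj₁ next))
                  (trans (cong suc (≡-sym (+-suc (size c) s′))) room) cov ,
            numeral-append W (digits I (c ▸ (x , y))) (nbrs-in I (proj₁ (proj₁ next))) s′
                           (s≤s (s≤s (count-≤ _)))
      ... | inj₂ none = WhenIsolated.walk P miss Ax iso cov c (suc s) valid fresh px∈c
                          (trans (+-suc (size c) s) room) padded
        where
          iso : Isolated I x
          iso {v} Iv = ¬-not (λ x~v → true≢false (∧-intro {I v} Iv x~v) (none v))
          padded : digits I c * W ^ suc s < suc (digits I c * W + nbrs-in I x) * W ^ s
          padded = ≤-<-trans (numeral-drop W (digits I c) (nbrs-in I x) s)
                             (*-monoˡ-< (W ^ s) {{m^n≢0 W s}} (n<1+n (digits I c * W + nbrs-in I x)))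

      -- Since the potential strictly decreases, potential + 1 steps suffice.
      run : (fuel : ℕ) (S : State) → potential S < fuel → Augmented I₀
      run zero       S ()
      run (suc fuel) S bd with step S
      ... | inj₁ augmented     = augmented
      ... | inj₂ (S′ , smaller) = run fuel S′ (<-≤-trans smaller (≤-pred bd))

    augment : ∀ {I₀} → Partial I₀ → Misses I₀ r → Augmented I₀
    augment {I₀} P miss = run (suc (potential start)) start ≤-refl
      where
        open Search I₀
        in-r : Σ (Fin n) λ v → A v ∧ does (part v ≟ r) ≡ true
        in-r with search (λ v → A v ∧ does (part v ≟ r))
        ... | inj₁ found = found
        ... | inj₂ none  = ⊥-elim (<⇒≱ (≤-trans q≥1 (class-size r)) (≤-reflexive (count-empty _ none)))
        x : Fin n
        x = proj₁ in-r
        nonempty : ∀ {k} → Fin k → Σ ℕ λ s → suc s ≡ k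
        nonempty {suc s} _ = s , refl
        start : State
        start = state I₀ ε x (proj₁ (nonempty x)) P miss tt
                      (∧-conicalˡ (A x) _ (proj₂ in-r) ,
                       here (does-sound (part x ≟ r) (∧-conicalʳ (A x) _ (proj₂ in-r))) , tt)
                      (proj₂ (nonempty x)) (λ j c → c)

  cover : (js : List (Fin m)) → Σ (Fin n → Bool) λ I → Partial I × (∀ {j} → j ∈ js → Covers I j)
  cover []       = (λ _ → false) , record { available = λ () ; independent = λ () ; rainbow = λ () } , λ ()
  cover (j ∷ js) with cover js
  ... | I , P , cov with search (λ v → I v ∧ does (part v ≟ j))
  ...   | inj₁ (v , e) = I , P , λ where
            (here refl) → v , ∧-conicalˡ (I v) _ e , does-sound (part v ≟ j) (∧-conicalʳ (I v) _ e)
            (there j∈js) → cov j∈js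
  ...   | inj₂ none with Augment.augment j P misses
    where misses : Misses I j
          misses {v} Iv pv≡j = true≢false (∧-intro {I v} Iv (dec-true (part v ≟ j) pv≡j)) (none v)
  ...     | I′ , P′ , I′⊒I , covers-j = I′ , P′ , λ where
            (here refl) → covers-j
            (there j∈js) → I′⊒I _ (cov j∈js)

  independent-transversal : Σ (Fin m → Fin n) λ t → (∀ j → part (t j) ≡ j) × (∀ j → A (t j) ≡ true) ×
                                                    (∀ j j′ → adj G (t j) (t j′) ≡ false)
  independent-transversal = t , (λ j → proj₂ (proj₂ (cov j))) , (λ j → available P (in-I j)) ,
                            (λ j j′ → independent P (in-I j) (in-I j′))
    where
      everything : Σ (Fin n → Bool) λ I → Partial I × (∀ {j} → j ∈ allFin m → Covers I j)
      everything = cover (allFin m)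
      P : Partial (proj₁ everything)
      P = proj₁ (proj₂ everything)
      cov : ∀ j → Covers (proj₁ everything) j
      cov j = proj₂ (proj₂ everything) (∈-allFin j)
      t : Fin m → Fin n
      t j = proj₁ (cov j)
      in-I : ∀ j → proj₁ everything (t j) ≡ true
      in-I j = proj₁ (proj₂ (cov j))

-- Disjoint independent transversals.  Under the same degree condition, if
-- every class has at least (k ∸ 1) + q vertices, there are k pairwise
-- disjoint independent transversals: once k − 1 are built, each class still
-- has q unused vertices, so one more can be found through unused vertices.
module DisjointTransversals
  {n m : ℕ} (G : Graph n) (part : Fin n → Fin m) (q : ℕ) (q≥1 : 1 ≤ q)
  (degree-bound : ∀ x y → deg G x + deg G y ≤ q) where

  class-size : Fin m → ℕ
  class-size j = count (λ v → does (part v ≟ j))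

  Family : ℕ → Set
  Family k = Σ (Fin k → Fin m → Fin n) λ T →
    (∀ i j → part (T i j) ≡ j) × (∀ i j j′ → adj G (T i j) (T i j′) ≡ false) ×
    (∀ i i′ → i ≢ i′ → ∀ j → T i j ≢ T i′ j)

  disjoint-transversals : ∀ k → (∀ j → k ∸ 1 + q ≤ class-size j) → Family k
  disjoint-transversals zero    _   = (λ ()) , (λ ()) , (λ ()) , (λ ())
  disjoint-transversals (suc k) big with disjoint-transversals k smaller
    where smaller : ∀ j → k ∸ 1 + q ≤ class-size j
          smaller j = ≤-trans (+-monoˡ-≤ q (m∸n≤m k 1)) (big j)
  ... | T , in-class , indep , disjoint = T′ , in-class′ , indep′ , disjoint′
    where
      unused : Fin n → Bool
      unused v = not (anyFin (λ i → does (T i (part v) ≟ v)))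

      -- Class j loses at most k vertices (one per earlier transversal).
      used-in : ∀ j → count (λ v → does (part v ≟ j) ∧ not (unused v)) ≤ k
      used-in j = ≤-trans (count-mono _ _ picked) (count-image k (λ i → T i j))
        where picked : ∀ v → does (part v ≟ j) ∧ not (unused v) ≡ true →
                             anyFin (λ i → does (T i j ≟ v)) ≡ true
              picked v e = subst (λ j′ → anyFin (λ i → does (T i j′ ≟ v)) ≡ true)
                                 (does-sound (part v ≟ j) (∧-conicalˡ _ _ e))
                                 (trans (≡-sym (not-involutive _)) (∧-conicalʳ (does (part v ≟ j)) _ e))

      enough : ∀ j → q ≤ count (λ v → unused v ∧ does (part v ≟ j))
      enough j = +-cancelˡ-≤ k q _ (begin
        k + q
          ≤⟨ big j ⟩
        class-size j
          ≤⟨ count-split _ unused ⟩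
        count (λ v → does (part v ≟ j) ∧ unused v) + count (λ v → does (part v ≟ j) ∧ not (unused v))
          ≤⟨ +-mono-≤ (≤-reflexive (count-cong _ _ (λ v → ∧-comm _ (unused v)))) (used-in j) ⟩
        count (λ v → unused v ∧ does (part v ≟ j)) + k
          ≡⟨ +-comm _ k ⟩
        k + count (λ v → unused v ∧ does (part v ≟ j)) ∎)
        where open ≤-Reasoning

      new : Σ (Fin m → Fin n) λ t → (∀ j → part (t j) ≡ j) × (∀ j → unused (t j) ≡ true) ×
                                    (∀ j j′ → adj G (t j) (t j′) ≡ false)
      new = IndependentTransversal.independent-transversal G part unused q q≥1 degree-bound enough
      t : Fin m → Fin n
      t = proj₁ new

      fresh : ∀ i j → t j ≢ T i j
      fresh i j t≡T = true≢false picked-by-T (anyFin-false _ (not-injective (proj₁ (proj₂ (proj₂ new)) j)) i)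
        where picked-by-T : does (T i (part (t j)) ≟ t j) ≡ true
              picked-by-T = dec-true (T i (part (t j)) ≟ t j) (trans (cong (T i) (proj₁ (proj₂ new) j)) (≡-sym t≡T))

      T′ : Fin (suc k) → Fin m → Fin n
      T′ zero    = t
      T′ (suc i) = T i
      in-class′ : ∀ i j → part (T′ i j) ≡ j
      in-class′ zero    = proj₁ (proj₂ new)
      in-class′ (suc i) = in-class i
      indep′ : ∀ i j j′ → adj G (T′ i j) (T′ i j′) ≡ false
      indep′ zero    = proj₂ (proj₂ (proj₂ new))
      indep′ (suc i) = indep i
      disjoint′ : ∀ i i′ → i ≢ i′ → ∀ j → T′ i j ≢ T′ i′ j
      disjoint′ zero    zero     i≢i′ = ⊥-elim (i≢i′ refl)
      disjoint′ zero    (suc i′) _    j = fresh i′ j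
      disjoint′ (suc i) zero     _    j = ≢-sym (fresh i j)
      disjoint′ (suc i) (suc i′) i≢i′ = disjoint i i′ (λ i≡i′ → i≢i′ (cong suc i≡i′))

  vertex-sets : ∀ {k} → Family k →
    Σ (Fin k → Fin n → Bool) λ S →
      (∀ i i′ → i ≢ i′ → ∀ v → ¬ (S i v ≡ true × S i′ v ≡ true)) ×
      (∀ i → Independent G (S i)) ×
      (∀ i j → ∃ λ v → S i v ≡ true × part v ≡ j)
  vertex-sets {k} (T , in-class , indep , disjoint) = S , disjoint-sets , independent-sets , meets
    where
      S : Fin k → Fin n → Bool
      S i v = does (T i (part v) ≟ v)
      member : ∀ i v → S i v ≡ true → T i (part v) ≡ v
      member i v = does-sound (T i (part v) ≟ v)
      disjoint-sets : ∀ i i′ → i ≢ i′ → ∀ v → ¬ (S i v ≡ true × S i′ v ≡ true)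
      disjoint-sets i i′ i≢i′ v (in-i , in-i′) =
        disjoint i i′ i≢i′ (part v) (trans (member i v in-i) (≡-sym (member i′ v in-i′)))
      independent-sets : ∀ i → Independent G (S i)
      independent-sets i u v in-u in-v =
        subst₂ (λ a b → adj G a b ≡ false) (member i u in-u) (member i v in-v) (indep i (part u) (part v))
      meets : ∀ i j → ∃ λ v → S i v ≡ true × part v ≡ j
      meets i j = T i j , dec-true (T i (part (T i j)) ≟ T i j) (cong (T i) (in-class i j)) , in-class i j

sum-≤-of-doubles : ∀ a b {q} → 2 * a < q → 2 * b < q → a + b ≤ q
sum-≤-of-doubles a b {q} 2a<q 2b<q = <⇒≤ (*-cancelˡ-< 2 (a + b) q (begin-strict
  2 * (a + b)    ≡⟨ *-distribˡ-+ 2 a b ⟩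
  2 * a + 2 * b  <⟨ +-mono-< 2a<q 2b<q ⟩
  q + q          ≡⟨ cong (q +_) (≡-sym (+-identityʳ q)) ⟩
  2 * q          ∎))
  where open ≤-Reasoning

2q∸1≡q∸1+q : ∀ q → 2 * q ∸ 1 ≡ q ∸ 1 + q
2q∸1≡q∸1+q zero    = refl
2q∸1≡q∸1+q (suc q) = cong (q +_) (+-identityʳ (suc q))

-- Theorem 5.5.  The degree condition gives N(x) + N(y) ≤ q for all x, y and
-- the class condition |V_j| ≥ 2q − 1 = (q ∸ 1) + q, so there are q disjoint
-- independent transversals; S_i is the vertex set of the i-th one.
theorem5p5 : (n m : ℕ) (G : Graph n) (part : Fin n → Fin m) (q : ℕ) →
    IsPrimePower q →
    (∀ v → 2 * deg G v + deg2 G v < q) →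
    (∀ j → 2 * q ∸ 1 ≤ count (λ v → does (part v ≟ j))) →
    Σ (Fin q → Fin n → Bool) λ S →
      (∀ i i′ → ¬ (i ≡ i′) → ∀ v → ¬ (S i v ≡ true × S i′ v ≡ true)) ×
      (∀ i → Independent G (S i)) ×
      (∀ i j → ∃ λ v → S i v ≡ true × part v ≡ j)
theorem5p5 n m G part zero      _ _                _               = (λ ()) , (λ ()) , (λ ()) , (λ ())
theorem5p5 n m G part q@(suc _) _ degree-condition class-condition =
  vertex-sets (disjoint-transversals q (λ j → subst (_≤ class-size j) (2q∸1≡q∸1+q q) (class-condition j)))
  where
    double-deg : ∀ v → 2 * deg G v < q
    double-deg v = ≤-<-trans (m≤m+n (2 * deg G v) (deg2 G v)) (degree-condition v)
    open DisjointTransversals G part q (s≤s z≤n)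
                              (λ x y → sum-≤-of-doubles (deg G x) (deg G y) (double-deg x) (double-deg y))
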